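{- Let $k\ge 2$ be an integer and let $H=(V,\mathcal{E})$ be a finite hypergraph which is hereditarily $k$-colorable. Set $\lambda=\frac{k}{k-1}$. Let $\mathcal{L}=\{L_v\}_{v\in V}$ be a family of finite sets of positive integers such that $\sum_{v\in V}\lambda^{ -|L_v|}<1$. Then $H$ admits a unique-maximum coloring from $\mathcal{L}$.
   Context: For $V'\subseteq V$, $H[V']=(V',\{S\cap V' : S\in\mathcal{E}\})$. A coloring is proper if every hyperedge with at least two vertices is non-monochromatic. $H$ is hereditarily $k$-colorable if for every $V'\subseteq V$, $H[V']$ admits a proper coloring with at most $k$ colors. A coloring $C\colon V\to\mathbb{Z}_{>0}$ is a unique-maximum coloring if for every hyperedge $S$, the maximum color appearing in $S$ appears on exactly one vertex of $S$. $H$ admits a unique-maximum coloring from $\mathcal{L}$ if there is such a coloring $C$ with $C(v)\in L_v$ for all $v\in V$. -}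

module Defs where

open import Data.Nat using (ℕ; zero; suc; _∸_; _<_; _≤_; NonZero)
open import Data.Fin using (Fin)
open import Data.Fin.Subset using (Subset; _∈_)
open import Data.Integer using (+_)
open import Data.Rational using (ℚ; _/_; _*_; _+_; 1ℚ; 0ℚ)
open import Data.List using (List)
open import Data.List.Relation.Unary.Any using (Any)
open import Data.List.Relation.Unary.All using (All)
open import Data.List.Relation.Unary.Unique.Propositional using (Unique)
open import Data.List.Membership.Propositional renaming (_∈_ to _∈ˡ_)
open import Data.Product using (Σ; ∃; _×_)
open import Relation.Binary.PropositionalEquality using (_≡_; _≢_)

record Hypergraph (n : ℕ) : Set where
  constructor hypergraph
  field
    edges : List (Subset n)
open Hypergraph public

_∈E_ : ∀ {n} → Subset n → Hypergraph n → Set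
S ∈E H = Any (S ≡_) (edges H)

-- A coloring c (with colors in Fin k) is proper on the induced
-- subhypergraph H[V']: every hyperedge S ∩ V' having at least two
-- vertices is not monochromatic.
ProperOn : ∀ {n k} → Hypergraph n → Subset n → (Fin n → Fin k) → Set
ProperOn H V' c =
  ∀ S → S ∈E H →
  (Σ (Fin _) λ u → Σ (Fin _) λ w → u ∈ S × u ∈ V' × w ∈ S × w ∈ V' × u ≢ w) →
  Σ (Fin _) λ u → Σ (Fin _) λ w → u ∈ S × u ∈ V' × w ∈ S × w ∈ V' × c u ≢ c w

HereditarilyColorable : ∀ {n} → ℕ → Hypergraph n → Set
HereditarilyColorable {n} k H =
  ∀ (V' : Subset n) → Σ (Fin n → Fin k) λ c → ProperOn H V' c

-- unique-maximum coloring: in every hyperedge S, the maximum color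
-- appearing in S appears on exactly one vertex (vacuous for empty S).
UniqueMaxColoring : ∀ {n} → Hypergraph n → (Fin n → ℕ) → Set
UniqueMaxColoring H C =
  ∀ S → S ∈E H → ∀ u → u ∈ S →
  Σ (Fin _) λ v → v ∈ S × (∀ w → w ∈ S → w ≢ v → C w < C v)

-- A list assignment: each L v is a finite set of positive integers
-- (a duplicate-free list of positive naturals).
IsListAssignment : ∀ {n} → (Fin n → List ℕ) → Set
IsListAssignment L = ∀ v → Unique (L v) × All (1 ≤_) (L v)

UniqueMaxColoringFrom : ∀ {n} → Hypergraph n → (Fin n → List ℕ) → Set
UniqueMaxColoringFrom H L =
  Σ (_ → ℕ) λ C → (∀ v → C v ∈ˡ L v) × UniqueMaxColoring H C

_^ℚ_ : ℚ → ℕ → ℚ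
q ^ℚ zero = 1ℚ
q ^ℚ suc m = q * (q ^ℚ m)

-- λ⁻¹ = (k-1)/k, where λ = k/(k-1); so λ^(-m) = ((k-1)/k)^m
lamInv : (k : ℕ) → .{{NonZero k}} → ℚ
lamInv k = (+ (k ∸ 1)) / k

sumFin : (n : ℕ) → (Fin n → ℚ) → ℚ
sumFin zero f = 0ℚ
sumFin (suc n) f = f Fin.zero + sumFin n (λ i → f (Fin.suc i))

module Submission where

-- Induction on the lists with a potential.  An uncoloured ("active") vertex v carries weight
-- λ^(-|L v|); the invariant is that the active weight is below 1.  Let c be the least colour on
-- an active list and W the active vertices whose list contains c.  Colour H[W] properly with k
-- colours and give c to a heaviest colour class I, which carries at least 1/k of the weight of W;
-- the vertices of I are retired and c is deleted from every list.  Each vertex of W ∖ I loses one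
-- colour, so its weight is multiplied by λ, and λ (w(W) − w(I)) ≤ λ (1 − 1/k) w(W) = w(W): the
-- invariant survives, and recursion colours the remaining active vertices with colours above c.
-- In an edge that still meets an active vertex, the recursive maximum stays the unique maximum;
-- an edge whose active vertices all lie in I has only one of them, as I is independent in H[W].

open import Defs
open import Algebra.Bundles using (CommutativeRing)
open import Data.Bool using (Bool; true; false; not; _∧_; if_then_else_; T)
open import Data.Bool.Properties using (T?; T-∧; T-≡)
open import Data.Empty using (⊥-elim)
open import Data.Fin using (Fin; zero; suc; _≟_)
open import Data.Fin.Properties using (any?)
open import Data.Fin.Subset using (_∈_)
import Data.Fin.Subset.Properties as Subset
import Data.Integer as ℤ
import Data.Integer.Properties as ℤ
open import Data.List using (List; []; _∷_; length; allFin; concatMap; filter)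
open import Data.List.Extrema.Nat using (argmax; f[xs]≤f[argmax]; min; argmin-all; min≤xs)
open import Data.List.Membership.Propositional using (lose) renaming (_∈_ to _∈ˡ_; _∉_ to _∉ˡ_)
open import Data.List.Membership.Propositional.Properties
  using (∈-allFin; ∈-filter⁻; ∈-concatMap⁺; ∈-concatMap⁻)
open import Data.List.Properties using (length-filter; filter-all; filter-accept; filter-reject)
open import Data.List.Relation.Unary.All as All using (_∷_)
open import Data.List.Relation.Unary.All.Properties using (¬Any⇒All¬)
open import Data.List.Relation.Unary.AllPairs using (_∷_)
open import Data.List.Relation.Unary.Any using (here; there; satisfied)
open import Data.List.Relation.Unary.Unique.Propositional using (Unique)
import Data.List.Relation.Unary.Unique.Propositional.Properties as Unique
open import Data.Nat using (ℕ; zero; suc; _+_; _*_; _∸_; _^_; _≤_; _<_; z≤n; s≤s; s≤s⁻¹; NonZero)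
open import Data.Nat.Properties hiding (_≟_)
import Data.Nat.Properties as ℕ
open import Data.Nat.Tactic.RingSolver using (solve-∀)
open import Data.List.Membership.DecPropositional ℕ._≟_ using () renaming (_∈?_ to _∈ˡ?_)
open import Data.Product using (∃-syntax; _×_; _,_; proj₁; proj₂)
open import Data.Rational using (ℚ; 1ℚ; toℚᵘ) renaming (_<_ to _<ℚ_; _+_ to _+ℚ_)
import Data.Rational.Properties as ℚ
open import Data.Rational.Unnormalised using (ℚᵘ; mkℚᵘ; _≃_; *≡*; *<*)
import Data.Rational.Unnormalised as ℚᵘ
import Data.Rational.Unnormalised.Properties as ℚᵘ
open import Data.Sum using (_⊎_; inj₁; inj₂)
open import Data.Vec using (tabulate)
open import Data.Vec.Properties using (lookup∘tabulate; []=⇒lookup; lookup⇒[]=)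
open import Function using (_∘_; id)
open import Function.Bundles using (Equivalence)
open import Relation.Binary.PropositionalEquality
open import Relation.Nullary using (Dec; yes; no; ¬_; does; ¬?)
open import Relation.Nullary.Decidable using (_×-dec_)

open import Algebra.Properties.Semiring.Sum +-*-semiring
  using (sum; ∑-comm; ∑-distrib-+; *-distribˡ-sum; sum-cong-≗; sum-replicate-zero)
open import Algebra.Properties.CommutativeSemigroup
  (CommutativeRing.*-commutativeSemigroup ℚᵘ.+-*-commutativeRing) using (interchange)

T-does : ∀ {P : Set} (P? : Dec P) → T (does P?) → P
T-does (yes p) _ = p

T-not-does : ∀ {P : Set} (P? : Dec P) → T (not (does P?)) → ¬ P
T-not-does (no ¬p) _ = ¬p

T-∧-not-split : ∀ {a d} → T a → T d ⊎ T (a ∧ not d)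
T-∧-not-split {true} {true}  _ = inj₁ _
T-∧-not-split {true} {false} _ = inj₂ _

if-T : ∀ {A : Set} {b} {x y : A} → T b → (if b then x else y) ≡ x
if-T {b = true} _ = refl

if-T-not : ∀ {A : Set} {b} {x y : A} → T (not b) → (if b then x else y) ≡ y
if-T-not {b = false} _ = refl

∈-tabulate⁺ : ∀ {n} (P : Fin n → Bool) {v} → T (P v) → v ∈ tabulate P
∈-tabulate⁺ P {v} Pv =
  lookup⇒[]= v (tabulate P) (trans (lookup∘tabulate P v) (Equivalence.to T-≡ Pv))

∈-tabulate⁻ : ∀ {n} (P : Fin n → Bool) {v} → v ∈ tabulate P → T (P v)
∈-tabulate⁻ P {v} v∈P = Equivalence.from T-≡ (trans (sym (lookup∘tabulate P v)) ([]=⇒lookup v∈P))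

_⇂_ : ∀ {n} → (Fin n → ℕ) → (Fin n → Bool) → Fin n → ℕ
(f ⇂ P) i = if P i then f i else 0

∑-mono-≤ : ∀ {n} {f g : Fin n → ℕ} → (∀ i → f i ≤ g i) → sum f ≤ sum g
∑-mono-≤ {zero}  f≤g = z≤n
∑-mono-≤ {suc n} f≤g = +-mono-≤ (f≤g zero) (∑-mono-≤ (f≤g ∘ suc))

∑-mono-< : ∀ {n} {f g : Fin n → ℕ} → (∀ i → f i ≤ g i) → ∀ i → f i < g i → sum f < sum g
∑-mono-< f≤g zero    fi<gi = +-mono-<-≤ fi<gi (∑-mono-≤ (f≤g ∘ suc))
∑-mono-< f≤g (suc i) fi<gi = +-mono-≤-< (f≤g zero) (∑-mono-< (f≤g ∘ suc) i fi<gi)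

f≤∑f : ∀ {n} (f : Fin n → ℕ) i → f i ≤ sum f
f≤∑f f zero    = m≤m+n _ _
f≤∑f f (suc i) = ≤-trans (f≤∑f (f ∘ suc) i) (m≤n+m _ _)

∑-bounded : ∀ {n} {f : Fin n → ℕ} {b} → (∀ i → f i ≤ b) → sum f ≤ n * b
∑-bounded {zero}  f≤b = z≤n
∑-bounded {suc n} f≤b = +-mono-≤ (f≤b zero) (∑-bounded (f≤b ∘ suc))

∑-δ : ∀ {n} (i : Fin n) x → sum (λ j → if does (i ≟ j) then x else 0) ≡ x
∑-δ {suc n} zero    x = trans (cong (x +_) (sum-replicate-zero n)) (+-identityʳ x)
∑-δ {suc n} (suc i) x = ∑-δ i x

heaviest-class : ∀ {n m} (col : Fin n → Fin (suc m)) (w : Fin n → ℕ) →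
  ∃[ j ] sum w ≤ suc m * sum (w ⇂ λ v → does (col v ≟ j))
heaviest-class {n} {m} col w = j , (begin
  sum w                                ≡⟨ sum-cong-≗ (λ v → ∑-δ (col v) (w v)) ⟨
  sum (λ v → sum (λ i → class i v))    ≡⟨ ∑-comm (λ v i → class i v) ⟩
  sum (λ i → sum (class i))            ≤⟨ ∑-bounded heaviest ⟩
  suc m * sum (class j)                ∎)
  where
  open ≤-Reasoning
  class : Fin (suc m) → Fin n → ℕ
  class i = w ⇂ λ v → does (col v ≟ i)
  j = argmax (sum ∘ class) zero (allFin (suc m))
  heaviest : ∀ i → sum (class i) ≤ sum (class j)
  heaviest i = All.lookup (f[xs]≤f[argmax] {f = sum ∘ class} zero (allFin (suc m))) (∈-allFin i)

delete : ℕ → List ℕ → List ℕ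
delete c = filter (λ x → ¬? (c ℕ.≟ x))

∈-delete⁻ : ∀ {c x xs} → x ∈ˡ delete c xs → x ∈ˡ xs × c ≢ x
∈-delete⁻ {c} = ∈-filter⁻ (λ x → ¬? (c ℕ.≟ x))

delete-∉ : ∀ {c xs} → c ∉ˡ xs → delete c xs ≡ xs
delete-∉ {c} {xs} c∉xs = filter-all (λ x → ¬? (c ℕ.≟ x)) (¬Any⇒All¬ xs c∉xs)

length-delete-∈ : ∀ {c xs} → Unique xs → c ∈ˡ xs → length xs ≡ suc (length (delete c xs))
length-delete-∈ {c} {x ∷ xs} (x∉xs ∷ _) (here refl) = cong (suc ∘ length) (sym (begin
  delete x (x ∷ xs)  ≡⟨ filter-reject (λ y → ¬? (x ℕ.≟ y)) (λ x≢x → x≢x refl) ⟩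
  delete x xs        ≡⟨ filter-all (λ y → ¬? (x ℕ.≟ y)) x∉xs ⟩
  xs                 ∎))
  where open ≡-Reasoning
length-delete-∈ {c} {x ∷ xs} (x∉xs ∷ u) (there c∈xs) = begin
  suc (length xs)                   ≡⟨ cong suc (length-delete-∈ u c∈xs) ⟩
  suc (length (x ∷ delete c xs))    ≡⟨ cong (suc ∘ length) (filter-accept P? c≢x) ⟨
  suc (length (delete c (x ∷ xs)))  ∎
  where
  open ≡-Reasoning
  P? = λ y → ¬? (c ℕ.≟ y)
  c≢x : c ≢ x
  c≢x c≡x = All.lookup x∉xs c∈xs (sym c≡x)

module _ {n} (A : Fin n → Bool) (L : Fin n → List ℕ) where

  activeList : Fin n → List ℕ
  activeList v = if A v then L v else []

  activeColours : List ℕ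
  activeColours = concatMap activeList (allFin n)

  ∈-activeColours⁺ : ∀ {v x} → T (A v) → x ∈ˡ L v → x ∈ˡ activeColours
  ∈-activeColours⁺ {v} Av x∈Lv = ∈-concatMap⁺ activeList (lose (∈-allFin v) (x∈ (A v) Av))
    where
    x∈ : ∀ b → T b → _ ∈ˡ (if b then L v else [])
    x∈ true _ = x∈Lv

  ∈-activeColours⁻ : ∀ {x} → x ∈ˡ activeColours → ∃[ v ] T (A v) × x ∈ˡ L v
  ∈-activeColours⁻ x∈ with v , x∈v ← satisfied (∈-concatMap⁻ activeList {allFin n} x∈) =
    v , x∈⁻ (A v) x∈v
    where
    x∈⁻ : ∀ {v x} b → x ∈ˡ (if b then L v else []) → T b × x ∈ˡ L v
    x∈⁻ true x∈ = _ , x∈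

  record LeastActiveColour : Set where
    field
      colour       : ℕ
      owner        : Fin n
      colour∈owner : colour ∈ˡ L owner
      colour-least : ∀ {v x} → T (A v) → x ∈ˡ L v → colour ≤ x

  leastActiveColour : ∀ {v x} → T (A v) → x ∈ˡ L v → LeastActiveColour
  leastActiveColour {x = x} Av x∈Lv = record
    { colour       = min x activeColours
    ; owner        = proj₁ owner
    ; colour∈owner = proj₂ (proj₂ owner)
    ; colour-least = λ Aw y∈Lw → All.lookup (min≤xs x activeColours) (∈-activeColours⁺ Aw y∈Lw)
    }
    where
    owner = ∈-activeColours⁻ (argmin-all id (∈-activeColours⁺ Av x∈Lv) (All.tabulate id))

-- Weights

-- weight (k − 1) N m = k^N λ^(−m) with λ = k/(k − 1): the weight of a list of length m, scaled
-- to a natural number.  It is meant for m ≤ N, as ∸ truncates.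
weight : (k-1 N m : ℕ) → ℕ
weight k-1 N m = k-1 ^ m * suc k-1 ^ (N ∸ m)

weight-zero : ∀ k-1 N → weight k-1 N 0 ≡ suc k-1 ^ N
weight-zero k-1 N = *-identityˡ (suc k-1 ^ N)

weight-step : ∀ k-1 {N m} → m < N → k-1 * weight k-1 N m ≡ suc k-1 * weight k-1 N (suc m)
weight-step k-1 {suc N} {m} (s≤s m≤N) rewrite +-∸-assoc 1 m≤N =
  shuffle k-1 (suc k-1) (k-1 ^ m) (suc k-1 ^ (N ∸ m))
  where
  shuffle : ∀ p q a b → p * (a * (q * b)) ≡ q * ((p * a) * b)
  shuffle = solve-∀

-- One vertex in one round: a says it is active, h that c is on its list, e that it lies in the
-- chosen colour class; x and x′ are its weights before and after deleting c.
vertex-balance : ∀ k-1 (a h e : Bool) {x x′} →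
  (T (not h) → x′ ≡ x) → (T h → k-1 * x′ ≡ suc k-1 * x) →
  k-1 * (if a ∧ not (h ∧ e) then x′ else 0) + suc k-1 * (if e then (if a ∧ h then x else 0) else 0)
    ≡ (if a ∧ h then x else 0) + k-1 * (if a then x else 0)
vertex-balance k-1 false _     true  _    _    rewrite *-zeroʳ k-1 = refl
vertex-balance k-1 false _     false _    _    rewrite *-zeroʳ k-1 = refl
vertex-balance k-1 true  false true  kept _    rewrite kept _ | *-zeroʳ k-1 = +-identityʳ (k-1 * _)
vertex-balance k-1 true  false false kept _    rewrite kept _ | *-zeroʳ k-1 = +-identityʳ (k-1 * _)
vertex-balance k-1 true  true  true  _    _    rewrite *-zeroʳ k-1 = refl
vertex-balance k-1 true  true  false _    lost rewrite lost _ | *-zeroʳ k-1 = +-identityʳ (suc k-1 * _)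

balance⇒≤ : ∀ {d} .{{_ : NonZero d}} {p′ i w p} →
  d * p′ + suc d * i ≡ w + d * p → w ≤ suc d * i → p′ ≤ p
balance⇒≤ {d} {p′} {i} {w} {p} balance w≤ =
  *-cancelˡ-≤ d (+-cancelʳ-≤ (suc d * i) (d * p′) (d * p) (begin
  d * p′ + suc d * i   ≡⟨ balance ⟩
  w + d * p            ≤⟨ +-monoˡ-≤ (d * p) w≤ ⟩
  suc d * i + d * p    ≡⟨ +-comm (suc d * i) (d * p) ⟩
  d * p + suc d * i    ∎))
  where open ≤-Reasoning

-- Clearing denominators

ι : ℕ → ℚᵘ
ι m = mkℚᵘ (ℤ.+ m) 0

ι-+ : ∀ a b → ι (a + b) ≃ ι a ℚᵘ.+ ι b
ι-+ a b = *≡* (trans (ℤ.*-identityʳ (ℤ.+ (a + b))) (trans (ℤ.pos-+ a b)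
  (sym (trans (ℤ.*-identityʳ _) (cong₂ ℤ._+_ (ℤ.*-identityʳ (ℤ.+ a)) (ℤ.*-identityʳ (ℤ.+ b)))))))

ι-* : ∀ a b → ι (a * b) ≃ ι a ℚᵘ.* ι b
ι-* a b = *≡* (trans (ℤ.*-identityʳ (ℤ.+ (a * b))) (trans (ℤ.pos-* a b) (sym (ℤ.*-identityʳ _))))

ι-cancel-< : ∀ {a b} → ι a ℚᵘ.< ι b → a < b
ι-cancel-< {a} {b} (*<* a<b) =
  ℤ.drop‿+<+ (subst₂ ℤ._<_ (ℤ.*-identityʳ (ℤ.+ a)) (ℤ.*-identityʳ (ℤ.+ b)) a<b)

ι-positive : ∀ m .{{_ : NonZero m}} → ℚᵘ.Positive (ι m)
ι-positive (suc m) = _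

scaled-sumFin : ∀ {n} K (f : Fin n → ℚ) (g : Fin n → ℕ) →
  (∀ v → toℚᵘ (f v) ℚᵘ.* ι K ≃ ι (g v)) → toℚᵘ (sumFin n f) ℚᵘ.* ι K ≃ ι (sum g)
scaled-sumFin {zero}  K f g fK≃g = ℚᵘ.*-zeroˡ (ι K)
scaled-sumFin {suc n} K f g fK≃g = begin
  toℚᵘ (f zero +ℚ ∑f′) ℚᵘ.* ι K
    ≈⟨ ℚᵘ.*-congʳ {ι K} (ℚ.toℚᵘ-homo-+ (f zero) ∑f′) ⟩
  (toℚᵘ (f zero) ℚᵘ.+ toℚᵘ ∑f′) ℚᵘ.* ι K
    ≈⟨ ℚᵘ.*-distribʳ-+ (ι K) (toℚᵘ (f zero)) (toℚᵘ ∑f′) ⟩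
  toℚᵘ (f zero) ℚᵘ.* ι K ℚᵘ.+ toℚᵘ ∑f′ ℚᵘ.* ι K
    ≈⟨ ℚᵘ.+-cong (fK≃g zero) (scaled-sumFin K (f ∘ suc) (g ∘ suc) (fK≃g ∘ suc)) ⟩
  ι (g zero) ℚᵘ.+ ι (sum (g ∘ suc))
    ≈⟨ ι-+ (g zero) (sum (g ∘ suc)) ⟨
  ι (sum g)
    ∎
  where
  open ℚᵘ.≃-Reasoning
  ∑f′ = sumFin n (f ∘ suc)

module _ (k-1 : ℕ) where
  private
    k = suc k-1
    λ⁻¹ = lamInv k

  λ⁻¹-scaled : toℚᵘ λ⁻¹ ℚᵘ.* ι k ≃ ι k-1
  λ⁻¹-scaled = ℚᵘ.≃-trans (ℚᵘ.*-congʳ (ℚ.toℚᵘ-fromℚᵘ (mkℚᵘ (ℤ.+ k-1) k-1)))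
    (*≡* (trans (ℤ.*-identityʳ (ℤ.+ k-1 ℤ.* ℤ.+ k))
                (cong (λ z → ℤ.+ k-1 ℤ.* ℤ.+ z) (sym (*-identityʳ k)))))

  λ⁻¹^-scaled : ∀ m → toℚᵘ (λ⁻¹ ^ℚ m) ℚᵘ.* ι (k ^ m) ≃ ι (k-1 ^ m)
  λ⁻¹^-scaled zero    = *≡* refl
  λ⁻¹^-scaled (suc m) = begin
    toℚᵘ (λ⁻¹ ^ℚ suc m) ℚᵘ.* ι (k ^ suc m)
      ≈⟨ ℚᵘ.*-cong (ℚ.toℚᵘ-homo-* λ⁻¹ (λ⁻¹ ^ℚ m)) (ι-* k (k ^ m)) ⟩
    (toℚᵘ λ⁻¹ ℚᵘ.* toℚᵘ (λ⁻¹ ^ℚ m)) ℚᵘ.* (ι k ℚᵘ.* ι (k ^ m))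
      ≈⟨ interchange (toℚᵘ λ⁻¹) (toℚᵘ (λ⁻¹ ^ℚ m)) (ι k) (ι (k ^ m)) ⟩
    (toℚᵘ λ⁻¹ ℚᵘ.* ι k) ℚᵘ.* (toℚᵘ (λ⁻¹ ^ℚ m) ℚᵘ.* ι (k ^ m))
      ≈⟨ ℚᵘ.*-cong λ⁻¹-scaled (λ⁻¹^-scaled m) ⟩
    ι k-1 ℚᵘ.* ι (k-1 ^ m)
      ≈⟨ ι-* k-1 (k-1 ^ m) ⟨
    ι (k-1 ^ suc m)
      ∎
    where open ℚᵘ.≃-Reasoning

  λ⁻¹^-weight : ∀ {N m} → m ≤ N → toℚᵘ (λ⁻¹ ^ℚ m) ℚᵘ.* ι (k ^ N) ≃ ι (weight k-1 N m)
  λ⁻¹^-weight {N} {m} m≤N = begin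
    μ ℚᵘ.* ι (k ^ N)
      ≡⟨ cong (λ e → μ ℚᵘ.* ι (k ^ e)) (m+[n∸m]≡n m≤N) ⟨
    μ ℚᵘ.* ι (k ^ (m + (N ∸ m)))
      ≡⟨ cong (λ e → μ ℚᵘ.* ι e) (^-distribˡ-+-* k m (N ∸ m)) ⟩
    μ ℚᵘ.* ι (k ^ m * k ^ (N ∸ m))
      ≈⟨ ℚᵘ.*-congˡ {μ} (ι-* (k ^ m) (k ^ (N ∸ m))) ⟩
    μ ℚᵘ.* (ι (k ^ m) ℚᵘ.* ι (k ^ (N ∸ m)))
      ≈⟨ ℚᵘ.*-assoc μ (ι (k ^ m)) (ι (k ^ (N ∸ m))) ⟨
    (μ ℚᵘ.* ι (k ^ m)) ℚᵘ.* ι (k ^ (N ∸ m))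
      ≈⟨ ℚᵘ.*-congʳ {ι (k ^ (N ∸ m))} (λ⁻¹^-scaled m) ⟩
    ι (k-1 ^ m) ℚᵘ.* ι (k ^ (N ∸ m))
      ≈⟨ ι-* (k-1 ^ m) (k ^ (N ∸ m)) ⟨
    ι (weight k-1 N m)
      ∎
    where
    open ℚᵘ.≃-Reasoning
    μ = toℚᵘ (λ⁻¹ ^ℚ m)

  weight-sum-bound : ∀ {n N} (m : Fin n → ℕ) → (∀ v → m v ≤ N) →
    sumFin n (λ v → λ⁻¹ ^ℚ m v) <ℚ 1ℚ → sum (weight k-1 N ∘ m) < k ^ N
  weight-sum-bound {n} {N} m m≤N ∑<1 = ι-cancel-< (begin-strict
    ι (sum (weight k-1 N ∘ m))
      ≃⟨ scaled-sumFin K _ _ (λ v → λ⁻¹^-weight (m≤N v)) ⟨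
    toℚᵘ (sumFin n (λ v → λ⁻¹ ^ℚ m v)) ℚᵘ.* ι K
      <⟨ ℚᵘ.*-monoˡ-<-pos (ι K) {{ι-positive K {{m^n≢0 k N}}}} (ℚ.toℚᵘ-mono-< ∑<1) ⟩
    ℚᵘ.1ℚᵘ ℚᵘ.* ι K
      ≃⟨ ℚᵘ.*-identityˡ (ι K) ⟩
    ι K
      ∎)
    where
    open ℚᵘ.≤-Reasoning
    K = k ^ N

-- The colouring procedure

module Construction (k-1 : ℕ) .{{_ : NonZero k-1}} {n} (H : Hypergraph n)
                    (hc : HereditarilyColorable (suc k-1) H) (N : ℕ) where
  private
    k = suc k-1

  UniqueMaxOn : (Fin n → Bool) → (Fin n → ℕ) → Set
  UniqueMaxOn A C = ∀ S → S ∈E H → ∀ u → u ∈ S → T (A u) →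
    ∃[ v ] v ∈ S × T (A v) × (∀ w → w ∈ S → T (A w) → w ≢ v → C w < C v)

  ListColoringOn : (Fin n → Bool) → (Fin n → List ℕ) → Set
  ListColoringOn A L = ∃[ C ] (∀ v → T (A v) → C v ∈ˡ L v) × UniqueMaxOn A C

  potential : (Fin n → Bool) → (Fin n → List ℕ) → Fin n → ℕ
  potential A L = (weight k-1 N ∘ length ∘ L) ⇂ A

  record Admissible (A : Fin n → Bool) (L : Fin n → List ℕ) : Set where
    field
      distinct : ∀ v → Unique (L v)
      short    : ∀ v → length (L v) ≤ N
      light    : sum (potential A L) < k ^ N

  active-nonempty : ∀ {A L v} → Admissible A L → T (A v) → ∃[ x ] x ∈ˡ L v
  active-nonempty {A} {L} {v} adm Av with L v in eq
  ... | x ∷ _ = x , here refl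
  ... | []    = ⊥-elim (<⇒≱ (Admissible.light adm) (begin
    k ^ N                          ≡⟨ weight-zero k-1 N ⟨
    weight k-1 N 0                 ≡⟨ cong (weight k-1 N ∘ length) eq ⟨
    weight k-1 N (length (L v))    ≡⟨ if-T Av ⟨
    potential A L v                ≤⟨ f≤∑f (potential A L) v ⟩
    sum (potential A L)            ∎))
    where open ≤-Reasoning

  module Round {A L} (adm : Admissible A L) {a} (Aa : T (A a)) where
    open Admissible adm

    opaque
      least : LeastActiveColour A L
      least = leastActiveColour A L Aa (proj₂ (active-nonempty adm Aa))

    open LeastActiveColour least renaming (colour to c; owner to v₀; colour∈owner to c∈Lv₀)

    has-c : Fin n → Bool
    has-c v = does (c ∈ˡ? L v)

    W : Fin n → Bool
    W v = A v ∧ has-c v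

    col : Fin n → Fin k
    col = proj₁ (hc (tabulate W))

    ω : Fin n → ℕ
    ω = weight k-1 N ∘ length ∘ L

    opaque
      j : Fin k
      j = proj₁ (heaviest-class col (ω ⇂ W))

      j-heaviest : sum (ω ⇂ W) ≤ k * sum ((ω ⇂ W) ⇂ λ v → does (col v ≟ j))
      j-heaviest = proj₂ (heaviest-class col (ω ⇂ W))

    in-j : Fin n → Bool
    in-j v = does (col v ≟ j)

    takes-c : Fin n → Bool
    takes-c v = has-c v ∧ in-j v

    A′ : Fin n → Bool
    A′ v = A v ∧ not (takes-c v)

    L′ : Fin n → List ℕ
    L′ v = delete c (L v)

    vertex-potential : ∀ v →
      k-1 * potential A′ L′ v + k * ((ω ⇂ W) ⇂ in-j) v ≡ (ω ⇂ W) v + k-1 * potential A L v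
    vertex-potential v = vertex-balance k-1 (A v) (has-c v) (in-j v) kept lost
      where
      kept : T (not (has-c v)) → weight k-1 N (length (L′ v)) ≡ ω v
      kept c∉Lv = cong (weight k-1 N ∘ length) (delete-∉ (T-not-does (c ∈ˡ? L v) c∉Lv))
      lost : T (has-c v) → k-1 * weight k-1 N (length (L′ v)) ≡ k * ω v
      lost c∈Lv = trans (weight-step k-1 (≤-trans (≤-reflexive (sym shrinks)) (short v)))
                        (cong (λ m → k * weight k-1 N m) (sym shrinks))
        where shrinks = length-delete-∈ (distinct v) (T-does (c ∈ˡ? L v) c∈Lv)

    potential-balance :
      k-1 * sum (potential A′ L′) + k * sum ((ω ⇂ W) ⇂ in-j)
        ≡ sum (ω ⇂ W) + k-1 * sum (potential A L)
    potential-balance = begin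
      k-1 * sum (potential A′ L′) + k * sum ((ω ⇂ W) ⇂ in-j)
        ≡⟨ cong₂ _+_ (*-distribˡ-sum k-1 (potential A′ L′)) (*-distribˡ-sum k ((ω ⇂ W) ⇂ in-j)) ⟩
      sum (λ v → k-1 * potential A′ L′ v) + sum (λ v → k * ((ω ⇂ W) ⇂ in-j) v)
        ≡⟨ ∑-distrib-+ (λ v → k-1 * potential A′ L′ v) (λ v → k * ((ω ⇂ W) ⇂ in-j) v) ⟨
      sum (λ v → k-1 * potential A′ L′ v + k * ((ω ⇂ W) ⇂ in-j) v)
        ≡⟨ sum-cong-≗ vertex-potential ⟩
      sum (λ v → (ω ⇂ W) v + k-1 * potential A L v)
        ≡⟨ ∑-distrib-+ (ω ⇂ W) (λ v → k-1 * potential A L v) ⟩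
      sum (ω ⇂ W) + sum (λ v → k-1 * potential A L v)
        ≡⟨ cong (sum (ω ⇂ W) +_) (*-distribˡ-sum k-1 (potential A L)) ⟨
      sum (ω ⇂ W) + k-1 * sum (potential A L)
        ∎
      where open ≡-Reasoning

    admissible′ : Admissible A′ L′
    admissible′ = record
      { distinct = λ v → Unique.filter⁺ (λ x → ¬? (c ℕ.≟ x)) (distinct v)
      ; short    = λ v → ≤-trans (length-filter (λ x → ¬? (c ℕ.≟ x)) (L v)) (short v)
      ; light    = ≤-<-trans (balance⇒≤ potential-balance j-heaviest) light
      }

    fewer-colours : sum (length ∘ L′) < sum (length ∘ L)
    fewer-colours = ∑-mono-< (λ v → length-filter (λ x → ¬? (c ℕ.≟ x)) (L v)) v₀
                             (≤-reflexive (sym (length-delete-∈ (distinct v₀) c∈Lv₀)))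

    A′⇒A : ∀ {v} → T (A′ v) → T (A v)
    A′⇒A {v} = proj₁ ∘ Equivalence.to (T-∧ {A v})

    A′⇒¬takes-c : ∀ {v} → T (A′ v) → T (not (takes-c v))
    A′⇒¬takes-c {v} = proj₂ ∘ Equivalence.to (T-∧ {A v})

    takes-c⇒c∈L : ∀ {v} → T (takes-c v) → c ∈ˡ L v
    takes-c⇒c∈L {v} = T-does (c ∈ˡ? L v) ∘ proj₁ ∘ Equivalence.to (T-∧ {has-c v})

    takes-c⇒in-j : ∀ {v} → T (takes-c v) → col v ≡ j
    takes-c⇒in-j {v} = T-does (col v ≟ j) ∘ proj₂ ∘ Equivalence.to (T-∧ {has-c v})

    ¬A′⇒takes-c : ∀ {v} → T (A v) → ¬ T (A′ v) → T (takes-c v)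
    ¬A′⇒takes-c {v} Av ¬A′v with T-∧-not-split {A v} {takes-c v} Av
    ... | inj₁ tc  = tc
    ... | inj₂ A′v = ⊥-elim (¬A′v A′v)

    retired⇒∈W : ∀ {v} → T (A v) → ¬ T (A′ v) → v ∈ tabulate W
    retired⇒∈W {v} Av ¬A′v = ∈-tabulate⁺ W (Equivalence.from (T-∧ {A v})
      (Av , proj₁ (Equivalence.to (T-∧ {has-c v}) (¬A′⇒takes-c Av ¬A′v))))

    retired⇒in-j : ∀ {v} → v ∈ tabulate W → ¬ T (A′ v) → col v ≡ j
    retired⇒in-j {v} v∈W =
      takes-c⇒in-j ∘ ¬A′⇒takes-c (proj₁ (Equivalence.to (T-∧ {A v}) (∈-tabulate⁻ W v∈W)))

    -- The colour class j is independent in H[W].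
    lone-active : ∀ {S} → S ∈E H → (∀ v → v ∈ S → ¬ T (A′ v)) →
                  ∀ {u w} → u ∈ S → T (A u) → w ∈ S → T (A w) → w ≡ u
    lone-active {S} S∈H none {u} {w} u∈S Au w∈S Aw with w ≟ u
    ... | yes w≡u = w≡u
    ... | no  w≢u with u′ , w′ , u′∈S , u′∈W , w′∈S , w′∈W , col≢ ←
                       proj₂ (hc (tabulate W)) S S∈H
                         (w , u , w∈S , retired⇒∈W Aw (none w w∈S) ,
                                    u∈S , retired⇒∈W Au (none u u∈S) , w≢u)
      = ⊥-elim (col≢ (trans (retired⇒in-j u′∈W (none u′ u′∈S))
                            (sym (retired⇒in-j w′∈W (none w′ w′∈S)))))

    module Extension (C′ : Fin n → ℕ) (C′∈L′ : ∀ v → T (A′ v) → C′ v ∈ˡ L′ v)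
                     (max′ : UniqueMaxOn A′ C′) where
      C : Fin n → ℕ
      C v = if takes-c v then c else C′ v

      C≡c : ∀ {v} → T (takes-c v) → C v ≡ c
      C≡c = if-T

      C≡C′ : ∀ {v} → T (A′ v) → C v ≡ C′ v
      C≡C′ = if-T-not ∘ A′⇒¬takes-c

      c<C′ : ∀ {v} → T (A′ v) → c < C′ v
      c<C′ {v} A′v with C′∈L , c≢C′ ← ∈-delete⁻ (C′∈L′ v A′v) =
        ≤∧≢⇒< (colour-least (A′⇒A A′v) C′∈L) c≢C′

      C∈L : ∀ v → T (A v) → C v ∈ˡ L v
      C∈L v Av with T-∧-not-split {A v} {takes-c v} Av
      ... | inj₁ tc  = subst (_∈ˡ L v) (sym (C≡c tc)) (takes-c⇒c∈L tc)
      ... | inj₂ A′v = subst (_∈ˡ L v) (sym (C≡C′ A′v)) (proj₁ (∈-delete⁻ (C′∈L′ v A′v)))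

      max′-survives : ∀ {S v} → T (A′ v) → (∀ w → w ∈ S → T (A′ w) → w ≢ v → C′ w < C′ v) →
                      ∀ w → w ∈ S → T (A w) → w ≢ v → C w < C v
      max′-survives A′v max w w∈S Aw w≢v with T-∧-not-split {A w} {takes-c w} Aw
      ... | inj₁ tc  = subst₂ _<_ (sym (C≡c tc)) (sym (C≡C′ A′v)) (c<C′ A′v)
      ... | inj₂ A′w = subst₂ _<_ (sym (C≡C′ A′w)) (sym (C≡C′ A′v)) (max w w∈S A′w w≢v)

      unique-max : UniqueMaxOn A C
      unique-max S S∈H u u∈S Au with any? (λ v → (v Subset.∈? S) ×-dec T? (A′ v))
      ... | yes (v , v∈S , A′v) with v′ , v′∈S , A′v′ , max ← max′ S S∈H v v∈S A′v =
        v′ , v′∈S , A′⇒A A′v′ , max′-survives A′v′ max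
      ... | no none = u , u∈S , Au , λ w w∈S Aw w≢u →
        ⊥-elim (w≢u (lone-active S∈H (λ v v∈S A′v → none (v , v∈S , A′v)) u∈S Au w∈S Aw))

    extend : ListColoringOn A′ L′ → ListColoringOn A L
    extend (C′ , C′∈L′ , max′) = C , C∈L , unique-max
      where open Extension C′ C′∈L′ max′

  listColoring : ∀ F {A L} → Admissible A L → sum (length ∘ L) < F → ListColoringOn A L
  listColoring zero    _   ()
  listColoring (suc F) {A} adm ∑<F with any? (λ v → T? (A v))
  ... | no none      =
    (λ _ → 0) , (λ v Av → ⊥-elim (none (v , Av))) , (λ _ _ u _ Au → ⊥-elim (none (u , Au)))
  ... | yes (a , Aa) = extend (listColoring F admissible′ (<-≤-trans fewer-colours (s≤s⁻¹ ∑<F)))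
    where open Round adm Aa

  ListColoringOn-all⇒UniqueMaxColoringFrom :
    ∀ {L} → ListColoringOn (λ _ → true) L → UniqueMaxColoringFrom H L
  ListColoringOn-all⇒UniqueMaxColoringFrom (C , C∈L , unique-max) =
    C , (λ v → C∈L v _) , λ S S∈H u u∈S →
      let v , v∈S , _ , max = unique-max S S∈H u u∈S _ in v , v∈S , λ w w∈S → max w w∈S _

mainTheorem3 : (k : ℕ) → .{{_ : NonZero k}} → 2 ≤ k →
    (n : ℕ) (H : Hypergraph n) → HereditarilyColorable k H →
    (L : Fin n → List ℕ) → IsListAssignment L →
    sumFin n (λ v → lamInv k ^ℚ length (L v)) <ℚ 1ℚ →
    UniqueMaxColoringFrom H L
mainTheorem3 (suc k-1@(suc _)) (s≤s (s≤s z≤n)) n H hc L isL ∑<1 =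
  ListColoringOn-all⇒UniqueMaxColoringFrom (listColoring (suc N) admissible ≤-refl)
  where
  N = sum (length ∘ L)
  open Construction k-1 H hc N
  admissible : Admissible (λ _ → true) L
  admissible = record
    { distinct = proj₁ ∘ isL
    ; short    = f≤∑f (length ∘ L)
    ; light    = weight-sum-bound k-1 (length ∘ L) (f≤∑f (length ∘ L)) ∑<1
    }
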